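{- For $n\ge1$ and $V_n=\{1,\dots,n\}$ let $f^*_1(n)$, $f^*_2(n)$, $f^*_3(n)$ be the numbers of graphs $G$ on vertex set $V_n$ such that, respectively, $\overline{G}$ is a disjoint union of stars and triangles; $\overline{G}$ is a disjoint union of stars and cliques; every component of $\overline{G}$ is the join of a clique and a stable set. Let $B_n$ be the $n$th Bell number. Then for $i=1,2,3$, $f^*_i(n)$ is monotone (non-decreasing) in $n$ and $B_n\le f^*_i(n)\le 2^nB_n$.
   Context: Stars $K_{1,t}$ with $t\ge0$ are allowed (including $K_1$), and the cliques and stable sets in the definitions may be empty. The join of two vertex-disjoint graphs is their disjoint union plus all edges between them. $B_n$ is the number of set partitions of an $n$-element set. -}

module Defs where

open import Data.Nat using (ℕ; zero; suc; _≤_; _*_; _^_)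
open import Data.Fin using (Fin)
open import Data.Fin.Properties using (_≟_)
open import Data.Bool using (Bool; true; false; not; if_then_else_)
open import Data.Product using (Σ; ∃; _×_; _,_)
open import Data.Sum using (_⊎_)
open import Relation.Nullary using (¬_)
open import Relation.Nullary.Decidable using (⌊_⌋)
open import Relation.Binary.PropositionalEquality using (_≡_; _≢_)
open import Relation.Binary.Construct.Closure.ReflexiveTransitive using (Star)

-- A binary Bool-valued relation on V_n = Fin n (vertices 0..n-1 stand for 1..n).
Rel₂ : ℕ → Set
Rel₂ n = Fin n → Fin n → Bool

IsGraph : {n : ℕ} → Rel₂ n → Set
IsGraph {n} G = (∀ i j → G i j ≡ G j i) × (∀ i → G i i ≡ false)

SameRel : {n : ℕ} → Rel₂ n → Rel₂ n → Set
SameRel R S = ∀ i j → R i j ≡ S i j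

complement : {n : ℕ} → Rel₂ n → Rel₂ n
complement G i j = if ⌊ i ≟ j ⌋ then false else not (G i j)

Adj : {n : ℕ} → Rel₂ n → Fin n → Fin n → Set
Adj G i j = G i j ≡ true

InComp : {n : ℕ} → Rel₂ n → Fin n → Fin n → Set
InComp G v u = Star (Adj G) v u

IsStarOn : {n : ℕ} → Rel₂ n → (Fin n → Set) → Set
IsStarOn {n} G S = Σ (Fin n) λ c → S c ×
  (∀ u w → S u → S w → u ≢ w → (Adj G u w → (u ≡ c ⊎ w ≡ c)) × ((u ≡ c ⊎ w ≡ c) → Adj G u w))

IsCliqueOn : {n : ℕ} → Rel₂ n → (Fin n → Set) → Set
IsCliqueOn G S = ∀ u w → S u → S w → u ≢ w → Adj G u w

IsTriangleOn : {n : ℕ} → Rel₂ n → (Fin n → Set) → Set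
IsTriangleOn {n} G S = IsCliqueOn G S × Σ (Fin n) λ a → Σ (Fin n) λ b → Σ (Fin n) λ c →
  (a ≢ b × a ≢ c × b ≢ c) × (S a × S b × S c) × (∀ u → S u → u ≡ a ⊎ u ≡ b ⊎ u ≡ c)

-- S is the join of a clique K and a stable set S∖K (either may be empty).
IsCliqueJoinStableOn : {n : ℕ} → Rel₂ n → (Fin n → Set) → Set
IsCliqueJoinStableOn {n} G S = Σ (Fin n → Bool) λ K →
  ∀ u w → S u → S w → u ≢ w →
    ((K u ≡ true → K w ≡ true → Adj G u w) ×
     (K u ≡ false → K w ≡ false → ¬ Adj G u w) ×
     (K u ≡ true → K w ≡ false → Adj G u w))

EveryComponent : {n : ℕ} → (Rel₂ n → (Fin n → Set) → Set) → Rel₂ n → Set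
EveryComponent C H = ∀ v → C H (InComp H v)

StarOrTriangle StarOrClique : {n : ℕ} → Rel₂ n → (Fin n → Set) → Set
StarOrTriangle G S = IsStarOn G S ⊎ IsTriangleOn G S
StarOrClique G S = IsStarOn G S ⊎ IsCliqueOn G S

Class : {n : ℕ} → Fin 3 → Rel₂ n → Set
Class Fin.zero G = EveryComponent StarOrTriangle (complement G)
Class (Fin.suc Fin.zero) G = EveryComponent StarOrClique (complement G)
Class (Fin.suc (Fin.suc Fin.zero)) G = EveryComponent IsCliqueJoinStableOn (complement G)

-- "the number of elements x of A (up to ≈) with P x is m":
-- an injective (up to ≈) enumeration by Fin m of exactly the P-elements.
IsCount : {A : Set} → (A → A → Set) → (A → Set) → ℕ → Set
IsCount {A} _≈_ P m = Σ (Fin m → A) λ e →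
  (∀ i → P (e i)) × (∀ i j → e i ≈ e j → i ≡ j) × (∀ x → P x → ∃ λ i → e i ≈ x)

GraphCount : Fin 3 → ℕ → ℕ → Set
GraphCount k n m = IsCount {Rel₂ n} SameRel (λ G → IsGraph G × Class k G) m

-- Set partitions of V_n correspond to equivalence relations on V_n.
IsEquivRel : {n : ℕ} → Rel₂ n → Set
IsEquivRel R = (∀ i → Adj R i i) × (∀ i j → Adj R i j → Adj R j i) ×
               (∀ i j k → Adj R i j → Adj R j k → Adj R i k)

BellCount : ℕ → ℕ → Set
BellCount n b = IsCount {Rel₂ n} SameRel IsEquivRel b

{-# OPTIONS --safe #-}
module Submission where

-- Adding a vertex adjacent to all others maps each class on V_n injectively into the class on
-- V_(n+1): in the complement the new vertex is an isolated K₁. A partition of V_n gives the graph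
-- whose complement is the forest of stars centred at the least element of each block; the blocks
-- are its components, so B_n ≤ f*_i(n). For the upper bound, all three classes lie in the third,
-- and in the complement H of such a graph every edge has an endpoint adjacent to its whole
-- component. Hence H, and with it G, is determined by the partition into components of H and the
-- set of vertices adjacent to their whole component, so f*_i(n) ≤ 2^n B_n. The counts exist since
-- the classes are decidable: these components have diameter at most two.

open import Defs
open import Data.Nat using (ℕ; zero; suc; _≤_; _*_; _^_)
open import Data.Nat.Properties using (≤-trans)
open import Data.Fin using (Fin; zero; suc; combine; remQuot)
open import Data.Fin.Properties using (_≟_; any?; all?; injective⇒≤; remQuot-combine; suc-injective)
open import Data.Bool using (Bool; true; false; not; if_then_else_; _∧_; _∨_)
open import Data.Bool.Properties using (not-involutive; not-injective) renaming (_≟_ to _≟ᵇ_)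
open import Data.Maybe using (Maybe; just; nothing; fromMaybe)
import Data.Maybe as Maybe
open import Data.Product using (Σ; ∃; _×_; _,_; proj₁; proj₂)
import Data.Product as Product
open import Data.Product.Relation.Binary.Pointwise.NonDependent using (×-isEquivalence)
import Data.Product.Relation.Binary.Pointwise.NonDependent as ×
open import Data.Sum using (_⊎_; inj₁; inj₂)
import Data.Sum
open import Data.Unit using (tt)
open import Data.Vec.Functional using (_∷_; [])
open import Data.Vec.Functional.Relation.Binary.Pointwise using (Pointwise)
import Data.Vec.Functional.Relation.Binary.Pointwise.Properties as Pointwise
open import Function using (_∘_; id; mk⇔)
open import Relation.Binary using (IsEquivalence; Decidable)
open import Relation.Nullary using (¬_; Dec; yes; no; does; contradiction)
open import Relation.Nullary.Decidable
  using (⌊_⌋; does-⇔; dec-true; dec-false; map′; _×-dec_; _⊎-dec_; _→-dec_; ¬?)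
open import Relation.Binary.PropositionalEquality using (_≡_; _≢_; refl; sym; trans; cong; cong₂; subst)
import Relation.Binary.PropositionalEquality as ≡
open import Relation.Binary.Construct.Closure.ReflexiveTransitive using (Star; ε; _◅_; _◅◅_; gmap; reverse)
import Relation.Binary.Construct.Closure.ReflexiveTransitive as Star
open import Relation.Unary using (U)

does⇒ : {A : Set} (a? : Dec A) → does a? ≡ true → A
does⇒ (yes a) _ = a
does⇒ (no _)  ()

does-false⇒¬ : {A : Set} (a? : Dec A) → does a? ≡ false → ¬ A
does-false⇒¬ (yes _) ()
does-false⇒¬ (no ¬a) _ = ¬a

bool-ext : {a b : Bool} → (a ≡ true → b ≡ true) → (b ≡ true → a ≡ true) → a ≡ b
bool-ext {true}  {true}  _ _ = refl
bool-ext {true}  {false} f _ = sym (f refl)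
bool-ext {false} {true}  _ g = g refl
bool-ext {false} {false} _ _ = refl

≡does : {A : Set} {b : Bool} (a? : Dec A) → (b ≡ true → A) → (A → b ≡ true) → b ≡ does a?
≡does a? to from = bool-ext (dec-true a? ∘ to) (from ∘ does⇒ a?)

module _ {A : Set} (_≈_ : A → A → Set) where

  InImage : {k : ℕ} → (Fin k → A) → A → Set
  InImage e x = ∃ λ i → e i ≈ x

  Onto : {k : ℕ} → (A → Set) → (Fin k → A) → Set
  Onto P e = ∀ x → P x → InImage e x

count-≤-enumeration : {A B : Set} {_≈ᴬ_ : A → A → Set} {_≈ᴮ_ : B → B → Set} {P : A → Set} {Q : B → Set}
                      {a b : ℕ} → IsEquivalence _≈ᴮ_ → IsCount _≈ᴬ_ P a →
                      (e : Fin b → B) → Onto _≈ᴮ_ Q e → (h : A → B) → (∀ {x} → P x → Q (h x)) →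
                      (∀ {x y} → P x → P y → h x ≈ᴮ h y → x ≈ᴬ y) → a ≤ b
count-≤-enumeration {_≈ᴮ_ = _≈ᴮ_} {a = a} {b} isEq (c , c-P , c-inj , _) e e-onto h h-PQ h-inj =
  injective⇒≤ index-injective
  where
  open IsEquivalence isEq using () renaming (sym to ≈-sym; trans to ≈-trans; reflexive to ≈-reflexive)
  index : Fin a → Fin b
  index i = proj₁ (e-onto (h (c i)) (h-PQ (c-P i)))
  index-sound : ∀ i → e (index i) ≈ᴮ h (c i)
  index-sound i = proj₂ (e-onto (h (c i)) (h-PQ (c-P i)))
  index-injective : ∀ {i j} → index i ≡ index j → i ≡ j
  index-injective {i} {j} eq = c-inj i j (h-inj (c-P i) (c-P j)
    (≈-trans (≈-sym (index-sound i)) (≈-trans (≈-reflexive (cong e eq)) (index-sound j))))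

count-≤-count : {A B : Set} {_≈ᴬ_ : A → A → Set} {_≈ᴮ_ : B → B → Set} {P : A → Set} {Q : B → Set}
                {a b : ℕ} → IsEquivalence _≈ᴮ_ → IsCount _≈ᴬ_ P a → IsCount _≈ᴮ_ Q b →
                (h : A → B) → (∀ {x} → P x → Q (h x)) →
                (∀ {x y} → P x → P y → h x ≈ᴮ h y → x ≈ᴬ y) → a ≤ b
count-≤-count isEq countP (e , _ , _ , e-onto) = count-≤-enumeration isEq countP e e-onto

module _ {A : Set} {_≈_ : A → A → Set} (isEq : IsEquivalence _≈_) (_≈?_ : Decidable _≈_)
         {P : A → Set} (P? : ∀ x → Dec (P x)) (P-resp : ∀ {x y} → x ≈ y → P x → P y) where
  open IsEquivalence isEq using () renaming (refl to ≈-refl; sym to ≈-sym; trans to ≈-trans)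

  private
    image-suc : ∀ {N x} {e : Fin (suc N) → A} → InImage _≈_ (e ∘ suc) x → InImage _≈_ e x
    image-suc (k , eq) = suc k , eq

    onto-skip : ∀ {N m} {e : Fin (suc N) → A} {c : Fin m → A} →
                (∀ {x} → P x → e zero ≈ x → InImage _≈_ c x) →
                Onto _≈_ (λ x → P x × InImage _≈_ (e ∘ suc) x) c →
                Onto _≈_ (λ x → P x × InImage _≈_ e x) c
    onto-skip at-zero c-onto x (Px , zero  , e₀≈x) = at-zero Px e₀≈x
    onto-skip at-zero c-onto x (Px , suc k , eₖ≈x) = c-onto x (Px , k , eₖ≈x)

  count-image : ∀ {N} (e : Fin N → A) → ∃ (IsCount _≈_ (λ x → P x × InImage _≈_ e x))
  count-image {zero} e = 0 , (λ ()) , (λ ()) , (λ ()) , λ { _ (_ , () , _) }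
  count-image {suc N} e with count-image (e ∘ suc)
  ... | m , c , c-P , c-inj , c-onto with P? (e zero) | any? (λ i → c i ≈? e zero)
  ... | no ¬Pe₀ | _ = m , c , Product.map₂ image-suc ∘ c-P , c-inj ,
    onto-skip (λ Px e₀≈x → contradiction (P-resp (≈-sym e₀≈x) Px) ¬Pe₀) c-onto
  ... | yes _ | yes (i , cᵢ≈e₀) = m , c , Product.map₂ image-suc ∘ c-P , c-inj ,
    onto-skip (λ _ e₀≈x → i , ≈-trans cᵢ≈e₀ e₀≈x) c-onto
  ... | yes Pe₀ | no fresh = suc m , e zero ∷ c , c'-P , c'-inj , c'-onto
    where
    c'-P : ∀ i → P ((e zero ∷ c) i) × InImage _≈_ e ((e zero ∷ c) i)
    c'-P zero    = Pe₀ , zero , ≈-refl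
    c'-P (suc i) = Product.map₂ image-suc (c-P i)
    c'-inj : ∀ i j → (e zero ∷ c) i ≈ (e zero ∷ c) j → i ≡ j
    c'-inj zero    zero    _ = refl
    c'-inj zero    (suc j) q = contradiction (j , ≈-sym q) fresh
    c'-inj (suc i) zero    q = contradiction (i , q) fresh
    c'-inj (suc i) (suc j) q = cong suc (c-inj i j q)
    c'-onto : Onto _≈_ (λ x → P x × InImage _≈_ e x) (e zero ∷ c)
    c'-onto x (Px , zero  , e₀≈x) = zero , e₀≈x
    c'-onto x (Px , suc k , eₖ≈x) = Product.map suc id (c-onto x (Px , k , eₖ≈x))

  count : ∀ {N} (e : Fin N → A) → Onto _≈_ U e → ∃ (IsCount _≈_ P)
  count e e-onto with count-image e
  ... | m , c , c-P , c-inj , c-onto = m , c , proj₁ ∘ c-P , c-inj , λ x Px → c-onto x (Px , e-onto x tt)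

pairs : {A B : Set} {a b : ℕ} → (Fin a → A) → (Fin b → B) → Fin (a * b) → A × B
pairs {b = b} e₁ e₂ = Product.map e₁ e₂ ∘ remQuot b

module _ {A B : Set} (_≈₁_ : A → A → Set) (_≈₂_ : B → B → Set) where

  pairs-onto : {a b : ℕ} {P : A → Set} {Q : B → Set} {e₁ : Fin a → A} {e₂ : Fin b → B} →
               Onto _≈₁_ P e₁ → Onto _≈₂_ Q e₂ →
               Onto (×.Pointwise _≈₁_ _≈₂_) (λ (x , y) → P x × Q y) (pairs e₁ e₂)
  pairs-onto {e₁ = e₁} {e₂} onto₁ onto₂ (x , y) (Px , Qy) with onto₁ x Px | onto₂ y Qy
  ... | i , e₁ᵢ≈x | j , e₂ⱼ≈y = combine i j ,
    subst (λ (i′ , j′) → e₁ i′ ≈₁ x × e₂ j′ ≈₂ y) (sym (remQuot-combine i j)) (e₁ᵢ≈x , e₂ⱼ≈y)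

functions : {A : Set} {a : ℕ} → (Fin a → A) → ∀ n → Fin (a ^ n) → (Fin n → A)
functions e zero    _ = []
functions e (suc n) k = Product.uncurry _∷_ (pairs e (functions e n) k)

module _ {A : Set} (_≈_ : A → A → Set) where

  functions-onto : {a : ℕ} {e : Fin a → A} → Onto _≈_ U e → ∀ n → Onto (Pointwise _≈_) U (functions e n)
  functions-onto onto zero    f _ = zero , λ ()
  functions-onto onto (suc n) f _
    with pairs-onto _≈_ (Pointwise _≈_) onto (functions-onto onto n) (f zero , f ∘ suc) (tt , tt)
  ... | k , head≈ , tail≈ = k , λ { zero → head≈ ; (suc i) → tail≈ i }

bools : Fin 2 → Bool
bools zero    = true
bools (suc _) = false

bools-onto : Onto _≡_ U bools
bools-onto true  _ = zero , refl
bools-onto false _ = suc zero , refl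

relations : ∀ n → Fin ((2 ^ n) ^ n) → Rel₂ n
relations n = functions (functions bools n) n

relations-onto : ∀ n → Onto SameRel U (relations n)
relations-onto n = functions-onto (Pointwise _≡_) (functions-onto _≡_ bools-onto n) n

module _ {n : ℕ} where

  sameRel-isEquivalence : IsEquivalence (SameRel {n})
  sameRel-isEquivalence = Pointwise.isEquivalence (Pointwise.isEquivalence ≡.isEquivalence n) n

  sameRel? : Decidable (SameRel {n})
  sameRel? R S = all? λ i → all? λ j → R i j ≟ᵇ S i j

  open IsEquivalence sameRel-isEquivalence public using ()
    renaming (refl to ≐-refl; sym to ≐-sym; trans to ≐-trans)

  count-relations : {P : Rel₂ n → Set} → (∀ R → Dec (P R)) → (∀ {R S} → SameRel R S → P R → P S) →
                    ∃ (IsCount SameRel P)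
  count-relations P? P-resp = count sameRel-isEquivalence sameRel? P? P-resp (relations n) (relations-onto n)

module _ {n : ℕ} where

  complement-diag : (G : Rel₂ n) (i : Fin n) → complement G i i ≡ false
  complement-diag G i with i ≟ i
  ... | yes _   = refl
  ... | no i≢i = contradiction refl i≢i

  complement-off : (G : Rel₂ n) {i j : Fin n} → i ≢ j → complement G i j ≡ not (G i j)
  complement-off G {i} {j} i≢j with i ≟ j
  ... | yes i≡j = contradiction i≡j i≢j
  ... | no _    = refl

  complement-cong : {G G' : Rel₂ n} → SameRel G G' → SameRel (complement G) (complement G')
  complement-cong G≐G' i j = cong (λ b → if ⌊ i ≟ j ⌋ then false else not b) (G≐G' i j)

  complement-isGraph : {G : Rel₂ n} → (∀ i j → G i j ≡ G j i) → IsGraph (complement G)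
  complement-isGraph {G} G-sym = complement-sym , complement-diag G
    where
    complement-sym : ∀ i j → complement G i j ≡ complement G j i
    complement-sym i j with i ≟ j | j ≟ i
    ... | yes _   | yes _   = refl
    ... | no _    | no _    = cong not (G-sym i j)
    ... | yes i≡j | no j≢i  = contradiction (sym i≡j) j≢i
    ... | no i≢j  | yes j≡i = contradiction (sym j≡i) i≢j

  complement-involutive : {H : Rel₂ n} → (∀ i → H i i ≡ false) → SameRel (complement (complement H)) H
  complement-involutive {H} H-irr i j with i ≟ j
  ... | yes refl = sym (H-irr i)
  ... | no _     = not-involutive (H i j)

  adj? : (H : Rel₂ n) (u w : Fin n) → Dec (Adj H u w)
  adj? H u w = H u w ≟ᵇ true

  adj-sym : {H : Rel₂ n} → IsGraph H → ∀ {u w} → Adj H u w → Adj H w u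
  adj-sym (H-sym , _) {u} {w} = trans (H-sym w u)

  adj⇒≢ : {H : Rel₂ n} → IsGraph H → ∀ {u w} → Adj H u w → u ≢ w
  adj⇒≢ (_ , H-irr) {u} uw refl with trans (sym uw) (H-irr u)
  ... | ()

  inComp-sym : {H : Rel₂ n} → IsGraph H → ∀ {v u} → InComp H v u → InComp H u v
  inComp-sym H-graph = reverse (adj-sym H-graph)

  inComp-resp : {H H' : Rel₂ n} → SameRel H H' → ∀ {v u} → InComp H v u → InComp H' v u
  inComp-resp H≐H' = Star.map λ {a} {b} → trans (sym (H≐H' a b))

  Near : Rel₂ n → Fin n → Fin n → Set
  Near H v u = v ≡ u ⊎ Adj H v u ⊎ ∃ λ a → Adj H v a × Adj H a u

  near? : (H : Rel₂ n) (v u : Fin n) → Dec (Near H v u)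
  near? H v u = (v ≟ u) ⊎-dec adj? H v u ⊎-dec any? λ a → adj? H v a ×-dec adj? H a u

  near⇒inComp : {H : Rel₂ n} {v u : Fin n} → Near H v u → InComp H v u
  near⇒inComp (inj₁ refl)                = ε
  near⇒inComp (inj₂ (inj₁ vu))           = vu ◅ ε
  near⇒inComp (inj₂ (inj₂ (_ , va , au))) = va ◅ au ◅ ε

  NearClosed : Rel₂ n → Set
  NearClosed H = ∀ v a u → Near H v a → Adj H a u → Near H v u

  nearClosed? : (H : Rel₂ n) → Dec (NearClosed H)
  nearClosed? H = all? λ v → all? λ a → all? λ u → near? H v a →-dec adj? H a u →-dec near? H v u

  nearClosed⇒inComp⇒near : {H : Rel₂ n} → NearClosed H → ∀ {v u} → InComp H v u → Near H v u
  nearClosed⇒inComp⇒near {H} closed {v} = extend (inj₁ refl)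
    where
    extend : ∀ {a u} → Near H v a → Star (Adj H) a u → Near H v u
    extend near ε          = near
    extend near (au ◅ path) = extend (closed _ _ _ near au) path

record InducedIso {n m : ℕ} (H : Rel₂ n) (S : Fin n → Set) (H' : Rel₂ m) (S' : Fin m → Set) : Set where
  field
    φ         : Fin n → Fin m
    injective : ∀ {u w} → φ u ≡ φ w → u ≡ w
    adjacency : ∀ u w → H' (φ u) (φ w) ≡ H u w
    into      : ∀ {u} → S u → S' (φ u)
    onto      : ∀ {x} → S' x → ∃ λ u → x ≡ φ u × S u

identityIso : {n : ℕ} {H H' : Rel₂ n} {S S' : Fin n → Set} → SameRel H H' →
              (∀ {u} → S u → S' u) → (∀ {u} → S' u → S u) → InducedIso H S H' S'
identityIso H≐H' into onto = record
  { φ = id ; injective = id ; adjacency = λ u w → sym (H≐H' u w)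
  ; into = into ; onto = λ s → _ , refl , onto s }

extend-along : {n m : ℕ} (φ : Fin n → Fin m) → (∀ {u w} → φ u ≡ φ w → u ≡ w) →
               (K : Fin n → Bool) → Σ (Fin m → Bool) λ K' → ∀ u → K' (φ u) ≡ K u
extend-along {m = m} φ φ-injective K = K' , K'∘φ
  where
  marked-preimage? : ∀ x → Dec (∃ λ u → φ u ≡ x × K u ≡ true)
  marked-preimage? x = any? λ u → (φ u ≟ x) ×-dec (K u ≟ᵇ true)
  K' : Fin m → Bool
  K' = does ∘ marked-preimage?
  K'∘φ : ∀ u → K' (φ u) ≡ K u
  K'∘φ u with K u in Ku
  ... | true  = dec-true (marked-preimage? (φ u)) (u , refl , Ku)
  ... | false = dec-false (marked-preimage? (φ u)) λ (w , φw≡φu , Kw) →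
    contradiction (trans (sym Kw) (trans (cong K (φ-injective φw≡φu)) Ku)) λ ()

module InducedIsoInvariance {n m : ℕ} {H : Rel₂ n} {S : Fin n → Set} {H' : Rel₂ m} {S' : Fin m → Set}
                            (iso : InducedIso H S H' S') where
  open InducedIso iso

  private
    adj⁺ : ∀ {u w} → Adj H u w → Adj H' (φ u) (φ w)
    adj⁺ {u} {w} = trans (adjacency u w)

    adj⁻ : ∀ {u w} → Adj H' (φ u) (φ w) → Adj H u w
    adj⁻ {u} {w} = trans (sym (adjacency u w))

    ≢⁻ : ∀ {u w} → φ u ≢ φ w → u ≢ w
    ≢⁻ φu≢φw = φu≢φw ∘ cong φ

    ≢⁺ : ∀ {u w} → u ≢ w → φ u ≢ φ w
    ≢⁺ u≢w = u≢w ∘ injective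

  isStarOn : IsStarOn H S → IsStarOn H' S'
  isStarOn (c , Sc , star) = φ c , into Sc , star'
    where
    star' : ∀ u' w' → S' u' → S' w' → u' ≢ w' →
            (Adj H' u' w' → u' ≡ φ c ⊎ w' ≡ φ c) × (u' ≡ φ c ⊎ w' ≡ φ c → Adj H' u' w')
    star' u' w' Su' Sw' u'≢w' with onto Su' | onto Sw'
    ... | u , refl , Su | w , refl , Sw with star u w Su Sw (≢⁻ u'≢w')
    ... | centred , adjacent =
      Data.Sum.map (cong φ) (cong φ) ∘ centred ∘ adj⁻ ,
      adj⁺ ∘ adjacent ∘ Data.Sum.map injective injective

  isCliqueOn : IsCliqueOn H S → IsCliqueOn H' S'
  isCliqueOn clique u' w' Su' Sw' u'≢w' with onto Su' | onto Sw'
  ... | u , refl , Su | w , refl , Sw = adj⁺ (clique u w Su Sw (≢⁻ u'≢w'))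

  isTriangleOn : IsTriangleOn H S → IsTriangleOn H' S'
  isTriangleOn (clique , a , b , c , (a≢b , a≢c , b≢c) , (Sa , Sb , Sc) , only-abc) =
    isCliqueOn clique , φ a , φ b , φ c , (≢⁺ a≢b , ≢⁺ a≢c , ≢⁺ b≢c) , (into Sa , into Sb , into Sc) ,
    only-abc'
    where
    only-abc' : ∀ u' → S' u' → u' ≡ φ a ⊎ u' ≡ φ b ⊎ u' ≡ φ c
    only-abc' u' Su' with onto Su'
    ... | u , refl , Su = Data.Sum.map (cong φ) (Data.Sum.map (cong φ) (cong φ)) (only-abc u Su)

  isCliqueJoinStableOn : IsCliqueJoinStableOn H S → IsCliqueJoinStableOn H' S'
  isCliqueJoinStableOn (K , split) with extend-along φ injective K
  ... | K' , K'∘φ≡K = K' , split'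
    where
    split' : ∀ u' w' → S' u' → S' w' → u' ≢ w' →
             (K' u' ≡ true → K' w' ≡ true → Adj H' u' w') ×
             (K' u' ≡ false → K' w' ≡ false → ¬ Adj H' u' w') ×
             (K' u' ≡ true → K' w' ≡ false → Adj H' u' w')
    split' u' w' Su' Sw' u'≢w' with onto Su' | onto Sw'
    ... | u , refl , Su | w , refl , Sw
      rewrite K'∘φ≡K u | K'∘φ≡K w with split u w Su Sw (≢⁻ u'≢w')
    ... | both , neither , one =
      (λ Ku Kw → adj⁺ (both Ku Kw)) , (λ Ku Kw → neither Ku Kw ∘ adj⁻) , (λ Ku Kw → adj⁺ (one Ku Kw))

module _ {n : ℕ} where

  Universal : Rel₂ n → (Fin n → Set) → Fin n → Set
  Universal H S x = ∀ w → S w → x ≢ w → Adj H x w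

  universal? : (H : Rel₂ n) {S : Fin n → Set} → (∀ u → Dec (S u)) → ∀ x → Dec (Universal H S x)
  universal? H S? x = all? λ w → S? w →-dec ¬? (x ≟ w) →-dec adj? H x w

  universal-mono : {H : Rel₂ n} {S S' : Fin n → Set} → (∀ {w} → S' w → S w) →
                   ∀ {x} → Universal H S x → Universal H S' x
  universal-mono S'⊆S univ w = univ w ∘ S'⊆S

  EdgesMeetUniversal : Rel₂ n → (Fin n → Set) → Set
  EdgesMeetUniversal H S =
    ∀ u w → S u → S w → u ≢ w → Adj H u w → Universal H S u ⊎ Universal H S w

  edgesMeetUniversal? : (H : Rel₂ n) {S : Fin n → Set} → (∀ u → Dec (S u)) → Dec (EdgesMeetUniversal H S)
  edgesMeetUniversal? H S? = all? λ u → all? λ w → S? u →-dec S? w →-dec ¬? (u ≟ w) →-dec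
    adj? H u w →-dec (universal? H S? u ⊎-dec universal? H S? w)

  cliqueJoinStable-clique⇒universal : {H : Rel₂ n} {S : Fin n → Set} (cjs : IsCliqueJoinStableOn H S) →
                                      ∀ {x} → S x → proj₁ cjs x ≡ true → Universal H S x
  cliqueJoinStable-clique⇒universal (K , split) {x} Sx Kx y Sy x≢y with K y in Ky
  ... | true  = proj₁ (split x y Sx Sy x≢y) Kx Ky
  ... | false = proj₂ (proj₂ (split x y Sx Sy x≢y)) Kx Ky

  cliqueJoinStable⇒edgesMeetUniversal : {H : Rel₂ n} {S : Fin n → Set} →
                                        IsCliqueJoinStableOn H S → EdgesMeetUniversal H S
  cliqueJoinStable⇒edgesMeetUniversal cjs@(K , split) u w Su Sw u≢w uw with K u in Ku | K w in Kw
  ... | true  | _     = inj₁ (cliqueJoinStable-clique⇒universal cjs Su Ku)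
  ... | false | true  = inj₂ (cliqueJoinStable-clique⇒universal cjs Sw Kw)
  ... | false | false = contradiction uw (proj₁ (proj₂ (split u w Su Sw u≢w)) Ku Kw)

  edgesMeetUniversal⇒cliqueJoinStable : {H : Rel₂ n} {S : Fin n → Set} → (∀ u → Dec (S u)) →
                                        EdgesMeetUniversal H S → IsCliqueJoinStableOn H S
  edgesMeetUniversal⇒cliqueJoinStable {H} S? edges = does ∘ universal? H S? , λ u w Su Sw u≢w →
      (λ Ku _ → does⇒ (universal? H S? u) Ku w Sw u≢w) ,
      (λ Ku Kw → Data.Sum.[ does-false⇒¬ (universal? H S? u) Ku , does-false⇒¬ (universal? H S? w) Kw ]
                 ∘ edges u w Su Sw u≢w) ,
      (λ Ku _ → does⇒ (universal? H S? u) Ku w Sw u≢w)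

  isCliqueJoinStableOn? : (H : Rel₂ n) {S : Fin n → Set} → (∀ u → Dec (S u)) →
                          Dec (IsCliqueJoinStableOn H S)
  isCliqueJoinStableOn? H S? = map′ (edgesMeetUniversal⇒cliqueJoinStable S?)
    cliqueJoinStable⇒edgesMeetUniversal (edgesMeetUniversal? H S?)

  isStarOn⇒isCliqueJoinStableOn : {H : Rel₂ n} {S : Fin n → Set} → IsStarOn H S → IsCliqueJoinStableOn H S
  isStarOn⇒isCliqueJoinStableOn (c , _ , star) = (λ x → does (x ≟ c)) , λ u w Su Sw u≢w →
    let centred , adjacent = star u w Su Sw u≢w in
    (λ Ku Kw → contradiction (trans (does⇒ (u ≟ c) Ku) (sym (does⇒ (w ≟ c) Kw))) u≢w) ,
    (λ Ku Kw → Data.Sum.[ does-false⇒¬ (u ≟ c) Ku , does-false⇒¬ (w ≟ c) Kw ] ∘ centred) ,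
    (λ Ku _ → adjacent (inj₁ (does⇒ (u ≟ c) Ku)))

  isCliqueOn⇒isCliqueJoinStableOn : {H : Rel₂ n} {S : Fin n → Set} → IsCliqueOn H S → IsCliqueJoinStableOn H S
  isCliqueOn⇒isCliqueJoinStableOn clique = (λ _ → true) , λ u w Su Sw u≢w →
    (λ _ _ → clique u w Su Sw u≢w) , (λ ()) , (λ _ ())

  isStarOn? : (H : Rel₂ n) {S : Fin n → Set} → (∀ u → Dec (S u)) → Dec (IsStarOn H S)
  isStarOn? H S? = any? λ c → S? c ×-dec all? λ u → all? λ w → S? u →-dec S? w →-dec ¬? (u ≟ w) →-dec
    ((adj? H u w →-dec ((u ≟ c) ⊎-dec (w ≟ c))) ×-dec (((u ≟ c) ⊎-dec (w ≟ c)) →-dec adj? H u w))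

  isCliqueOn? : (H : Rel₂ n) {S : Fin n → Set} → (∀ u → Dec (S u)) → Dec (IsCliqueOn H S)
  isCliqueOn? H S? = all? λ u → all? λ w → S? u →-dec S? w →-dec ¬? (u ≟ w) →-dec adj? H u w

  isTriangleOn? : (H : Rel₂ n) {S : Fin n → Set} → (∀ u → Dec (S u)) → Dec (IsTriangleOn H S)
  isTriangleOn? H S? = isCliqueOn? H S? ×-dec any? λ a → any? λ b → any? λ c →
    (¬? (a ≟ b) ×-dec ¬? (a ≟ c) ×-dec ¬? (b ≟ c)) ×-dec (S? a ×-dec S? b ×-dec S? c) ×-dec
    all? λ u → S? u →-dec ((u ≟ a) ⊎-dec (u ≟ b) ⊎-dec (u ≟ c))

  -- Along a path v — a — ⋯ — u, whichever of v, a is universal in the component is within one step of u.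
  cliqueJoinStable⇒near : {H : Rel₂ n} → IsGraph H → ∀ {v} → IsCliqueJoinStableOn H (InComp H v) →
                          ∀ {u} → InComp H v u → Near H v u
  cliqueJoinStable⇒near H-graph cjs ε = inj₁ refl
  cliqueJoinStable⇒near H-graph {v} cjs {u} (_◅_ {j = a} va au)
    with cliqueJoinStable⇒edgesMeetUniversal cjs v a ε (va ◅ ε) (adj⇒≢ H-graph va) va
  ... | inj₁ v-universal with v ≟ u
  ...   | yes v≡u = inj₁ v≡u
  ...   | no v≢u  = inj₂ (inj₁ (v-universal u (va ◅ au) v≢u))
  cliqueJoinStable⇒near H-graph {v} cjs {u} (_◅_ {j = a} va au) | inj₂ a-universal with a ≟ u
  ...   | yes refl = inj₂ (inj₁ va)
  ...   | no a≢u   = inj₂ (inj₂ (a , va , a-universal u (va ◅ au) a≢u))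

ComponentProperty : Set₁
ComponentProperty = ∀ {n} → Rel₂ n → (Fin n → Set) → Set

record Admissible (C : ComponentProperty) : Set₁ where
  field
    invariant        : ∀ {n m} {H : Rel₂ n} {S : Fin n → Set} {H' : Rel₂ m} {S' : Fin m → Set} →
                       InducedIso H S H' S' → C H S → C H' S'
    cliqueJoinStable : ∀ {n} {H : Rel₂ n} {S : Fin n → Set} → C H S → IsCliqueJoinStableOn H S
    decide           : ∀ {n} (H : Rel₂ n) {S : Fin n → Set} → (∀ u → Dec (S u)) → Dec (C H S)
    star             : ∀ {n} {H : Rel₂ n} {S : Fin n → Set} → IsStarOn H S → C H S

open InducedIsoInvariance

starOrTriangle-admissible : Admissible StarOrTriangle
starOrTriangle-admissible = record
  { invariant        = λ iso → Data.Sum.map (isStarOn iso) (isTriangleOn iso)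
  ; cliqueJoinStable = Data.Sum.[ isStarOn⇒isCliqueJoinStableOn , isCliqueOn⇒isCliqueJoinStableOn ∘ proj₁ ]
  ; decide           = λ H S? → isStarOn? H S? ⊎-dec isTriangleOn? H S?
  ; star             = inj₁ }

starOrClique-admissible : Admissible StarOrClique
starOrClique-admissible = record
  { invariant        = λ iso → Data.Sum.map (isStarOn iso) (isCliqueOn iso)
  ; cliqueJoinStable = Data.Sum.[ isStarOn⇒isCliqueJoinStableOn , isCliqueOn⇒isCliqueJoinStableOn ]
  ; decide           = λ H S? → isStarOn? H S? ⊎-dec isCliqueOn? H S?
  ; star             = inj₁ }

cliqueJoinStable-admissible : Admissible IsCliqueJoinStableOn
cliqueJoinStable-admissible = record
  { invariant        = isCliqueJoinStableOn
  ; cliqueJoinStable = id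
  ; decide           = isCliqueJoinStableOn?
  ; star             = isStarOn⇒isCliqueJoinStableOn }

InClass : ComponentProperty → {n : ℕ} → Rel₂ n → Set
InClass C G = IsGraph G × EveryComponent C (complement G)

module _ {C : ComponentProperty} (C-admissible : Admissible C) {n : ℕ} where
  open Admissible C-admissible

  everyComponent-resp : {H H' : Rel₂ n} → SameRel H H' → EveryComponent C H → EveryComponent C H'
  everyComponent-resp H≐H' every v =
    invariant (identityIso H≐H' (inComp-resp H≐H') (inComp-resp (≐-sym H≐H'))) (every v)

  everyComponent⇒nearClosed : {H : Rel₂ n} → IsGraph H → EveryComponent C H → NearClosed H
  everyComponent⇒nearClosed H-graph every v a u near au =
    cliqueJoinStable⇒near H-graph (cliqueJoinStable (every v)) (near⇒inComp near ◅◅ au ◅ ε)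

  -- Under C components have diameter at most two, so EveryComponent C H amounts to
  -- NearClosed H together with C on the balls Near H v, both of which are decidable.
  everyComponent? : (H : Rel₂ n) → IsGraph H → Dec (EveryComponent C H)
  everyComponent? H H-graph with nearClosed? H
  ... | no ¬closed = no (¬closed ∘ everyComponent⇒nearClosed H-graph)
  ... | yes closed = map′
    (λ balls v → invariant (identityIso ≐-refl near⇒inComp (nearClosed⇒inComp⇒near closed)) (balls v))
    (λ every v → invariant (identityIso ≐-refl (nearClosed⇒inComp⇒near closed) near⇒inComp) (every v))
    (all? λ v → decide H (near? H v))

  inClass-resp : {G G' : Rel₂ n} → SameRel G G' → InClass C G → InClass C G'
  inClass-resp G≐G' ((G-sym , G-irr) , every) =
    ((λ i j → trans (sym (G≐G' i j)) (trans (G-sym i j) (G≐G' j i))) ,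
     (λ i → trans (sym (G≐G' i i)) (G-irr i))) ,
    everyComponent-resp (complement-cong G≐G') every

  inClass? : (G : Rel₂ n) → Dec (InClass C G)
  inClass? G with (all? λ i → all? λ j → G i j ≟ᵇ G j i) ×-dec (all? λ i → G i i ≟ᵇ false)
  ... | no ¬graph = no (¬graph ∘ proj₁)
  ... | yes graph =
    map′ (graph ,_) proj₂ (everyComponent? (complement G) (complement-isGraph (proj₁ graph)))

  count-class : ∃ (IsCount SameRel (InClass C {n}))
  count-class = count-relations inClass? inClass-resp

-- Monotonicity: adding a universal vertex

cone : {n : ℕ} → Rel₂ n → Rel₂ (suc n)
cone G zero    zero    = false
cone G zero    (suc _) = true
cone G (suc _) zero    = true
cone G (suc i) (suc j) = G i j

module _ {n : ℕ} {G : Rel₂ n} where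

  cone-isGraph : IsGraph G → IsGraph (cone G)
  cone-isGraph (G-sym , G-irr) = cone-sym , cone-irr
    where
    cone-sym : ∀ i j → cone G i j ≡ cone G j i
    cone-sym zero    zero    = refl
    cone-sym zero    (suc _) = refl
    cone-sym (suc _) zero    = refl
    cone-sym (suc i) (suc j) = G-sym i j
    cone-irr : ∀ i → cone G i i ≡ false
    cone-irr zero    = refl
    cone-irr (suc i) = G-irr i

  cone-injective : {G' : Rel₂ n} → SameRel (cone G) (cone G') → SameRel G G'
  cone-injective cG≐cG' i j = cG≐cG' (suc i) (suc j)

  complement-cone-suc : ∀ i j → complement (cone G) (suc i) (suc j) ≡ complement G i j
  complement-cone-suc i j with i ≟ j
  ... | yes _ = refl
  ... | no _  = refl

  complement-cone-apex : ∀ {x} → InComp (complement (cone G)) zero x → x ≡ zero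
  complement-cone-apex ε                         = refl
  complement-cone-apex (_◅_ {j = zero}  () _)
  complement-cone-apex (_◅_ {j = suc _} () _)

  complement-cone-component : ∀ {a x} → InComp (complement (cone G)) (suc a) x →
                              ∃ λ u → x ≡ suc u × InComp (complement G) a u
  complement-cone-component ε                          = _ , refl , ε
  complement-cone-component (_◅_ {j = zero}  () _)
  complement-cone-component {a} (_◅_ {j = suc b} ab path) =
    Product.map id (Product.map id (trans (sym (complement-cone-suc a b)) ab ◅_))
      (complement-cone-component path)

  complement-cone-iso : ∀ v → InducedIso (complement G) (InComp (complement G) v)
                                         (complement (cone G)) (InComp (complement (cone G)) (suc v))
  complement-cone-iso v = record
    { φ = suc ; injective = suc-injective ; adjacency = complement-cone-suc
    ; into = gmap suc λ {a} {b} → trans (complement-cone-suc a b) ; onto = complement-cone-component }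

  cone-inClass : {C : ComponentProperty} → Admissible C → InClass C G → InClass C (cone G)
  cone-inClass {C} C-admissible (G-graph , every) = cone-isGraph G-graph , every⁺
    where
    open Admissible C-admissible
    every⁺ : EveryComponent C (complement (cone G))
    every⁺ zero    = star (zero , ε , λ u w Su Sw u≢w →
      contradiction (trans (complement-cone-apex Su) (sym (complement-cone-apex Sw))) u≢w)
    every⁺ (suc v) = invariant (complement-cone-iso v) (every v)

-- Lower bound: star forests of partitions

module _ {n : ℕ} where

  isEquivRel? : (R : Rel₂ n) → Dec (IsEquivRel R)
  isEquivRel? R = (all? λ i → adj? R i i) ×-dec
    (all? λ i → all? λ j → adj? R i j →-dec adj? R j i) ×-dec
    (all? λ i → all? λ j → all? λ k → adj? R i j →-dec adj? R j k →-dec adj? R i k)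

  isEquivRel-resp : {R R' : Rel₂ n} → SameRel R R' → IsEquivRel R → IsEquivRel R'
  isEquivRel-resp {R} {R'} R≐R' (R-refl , R-sym , R-trans) =
    (λ i → to (R-refl i)) , (λ i j → to ∘ R-sym i j ∘ from) ,
    (λ i j k ij jk → to (R-trans i j k (from ij) (from jk)))
    where
    to : ∀ {i j} → Adj R i j → Adj R' i j
    to {i} {j} = trans (sym (R≐R' i j))
    from : ∀ {i j} → Adj R' i j → Adj R i j
    from {i} {j} = trans (R≐R' i j)

  count-partitions : ∃ (BellCount n)
  count-partitions = count-relations isEquivRel? isEquivRel-resp

first : {n : ℕ} → (Fin n → Bool) → Maybe (Fin n)
first {zero}  p = nothing
first {suc n} p = if p zero then just zero else Maybe.map suc (first (p ∘ suc))

first-cong : {n : ℕ} {p q : Fin n → Bool} → (∀ i → p i ≡ q i) → first p ≡ first q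
first-cong {zero}          p≗q = refl
first-cong {suc n} {p} {q} p≗q rewrite p≗q zero =
  cong (λ r → if q zero then just zero else Maybe.map suc r) (first-cong (p≗q ∘ suc))

first-found : {n : ℕ} (p : Fin n → Bool) {i : Fin n} → p i ≡ true → ∃ λ j → first p ≡ just j × p j ≡ true
first-found {suc n} p {i} pi with p zero in p₀
... | true  = zero , refl , p₀
... | false with i
...   | zero  = contradiction (trans (sym pi) p₀) λ ()
...   | suc i′ with first-found (p ∘ suc) pi
...     | j , first≡j , pj rewrite first≡j = suc j , refl , pj

module _ {n : ℕ} (R : Rel₂ n) where

  -- The least element of the block of v; the fallback v is reached only if R v v fails.
  centre : Fin n → Fin n
  centre v = fromMaybe v (first (λ i → R i v))

  StarEdge : Fin n → Fin n → Set
  StarEdge i j = i ≢ j × Adj R i j × (i ≡ centre i ⊎ j ≡ centre j)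

  starEdge? : ∀ i j → Dec (StarEdge i j)
  starEdge? i j = ¬? (i ≟ j) ×-dec adj? R i j ×-dec ((i ≟ centre i) ⊎-dec (j ≟ centre j))

  starForest : Rel₂ n
  starForest i j = does (starEdge? i j)

  partitionGraph : Rel₂ n
  partitionGraph = complement starForest

module StarForest {n : ℕ} {R : Rel₂ n} (R-equiv : IsEquivRel R) where

  private
    R-refl : ∀ i → Adj R i i
    R-refl = proj₁ R-equiv
    R-sym : ∀ {i j} → Adj R i j → Adj R j i
    R-sym = proj₁ (proj₂ R-equiv) _ _
    R-trans : ∀ {i j k} → Adj R i j → Adj R j k → Adj R i k
    R-trans = proj₂ (proj₂ R-equiv) _ _ _

  centre-related : ∀ v → Adj R (centre R v) v
  centre-related v with first-found (λ i → R i v) (R-refl v)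
  ... | j , first≡j , Rjv rewrite first≡j = Rjv

  related⇒sameClass : ∀ {u v} → Adj R u v → ∀ i → R i u ≡ R i v
  related⇒sameClass Ruv i = bool-ext (λ Riu → R-trans Riu Ruv) (λ Riv → R-trans Riv (R-sym Ruv))

  centre-cong : ∀ {u v} → Adj R u v → centre R u ≡ centre R v
  centre-cong {u} {v} Ruv with first-found (λ i → R i v) (R-refl v) | first-cong (related⇒sameClass Ruv)
  ... | j , first≡j , _ | firsts≡ rewrite firsts≡ | first≡j = refl

  starEdge-sym : ∀ {i j} → StarEdge R i j → StarEdge R j i
  starEdge-sym (i≢j , Rij , centred) = i≢j ∘ sym , R-sym Rij , Data.Sum.swap centred

  starForest-isGraph : IsGraph (starForest R)
  starForest-isGraph =
    (λ i j → does-⇔ (mk⇔ starEdge-sym starEdge-sym) (starEdge? R i j) (starEdge? R j i)) ,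
    (λ i → dec-false (starEdge? R i i) λ (i≢i , _) → i≢i refl)

  centre-reachable : ∀ v → InComp (starForest R) v (centre R v)
  centre-reachable v with v ≟ centre R v
  ... | yes v≡c = subst (InComp (starForest R) v) v≡c ε
  ... | no v≢c  = dec-true (starEdge? R v (centre R v))
    (v≢c , R-sym (centre-related v) , inj₂ (sym (centre-cong (centre-related v)))) ◅ ε

  inComp⇒related : ∀ {v u} → InComp (starForest R) v u → Adj R v u
  inComp⇒related ε = R-refl _
  inComp⇒related (_◅_ {i = v} {j = a} va au) =
    R-trans (proj₁ (proj₂ (does⇒ (starEdge? R v a) va))) (inComp⇒related au)

  related⇒inComp : ∀ {v u} → Adj R v u → InComp (starForest R) v u
  related⇒inComp {v} {u} Rvu = centre-reachable v ◅◅
    subst (λ c → InComp (starForest R) c u) (sym (centre-cong Rvu))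
      (inComp-sym starForest-isGraph (centre-reachable u))

  components-are-stars : ∀ v → IsStarOn (starForest R) (InComp (starForest R) v)
  components-are-stars v = centre R v , centre-reachable v , λ u w Su Sw u≢w →
    let c≡cu = centre-cong (inComp⇒related Su)
        c≡cw = centre-cong (inComp⇒related Sw)
    in
    (λ uw → Data.Sum.map (λ u≡cu → trans u≡cu (sym c≡cu)) (λ w≡cw → trans w≡cw (sym c≡cw))
              (proj₂ (proj₂ (does⇒ (starEdge? R u w) uw)))) ,
    (λ centred → dec-true (starEdge? R u w)
      (u≢w , R-trans (R-sym (inComp⇒related Su)) (inComp⇒related Sw) ,
       Data.Sum.map (λ u≡c → trans u≡c c≡cu) (λ w≡c → trans w≡c c≡cw) centred))

  partitionGraph-inClass : {C : ComponentProperty} → Admissible C → InClass C (partitionGraph R)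
  partitionGraph-inClass C-admissible =
    complement-isGraph (proj₁ starForest-isGraph) ,
    everyComponent-resp C-admissible (≐-sym (complement-involutive (proj₂ starForest-isGraph)))
      (Admissible.star C-admissible ∘ components-are-stars)

module _ {n : ℕ} {R R' : Rel₂ n} (R-equiv : IsEquivRel R) (R'-equiv : IsEquivRel R') where

  starForest-injective : SameRel (starForest R) (starForest R') → SameRel R R'
  starForest-injective F≐F' i j = bool-ext
    (StarForest.inComp⇒related R'-equiv ∘ inComp-resp F≐F' ∘ StarForest.related⇒inComp R-equiv)
    (StarForest.inComp⇒related R-equiv ∘ inComp-resp (≐-sym F≐F') ∘ StarForest.related⇒inComp R'-equiv)

  partitionGraph-injective : SameRel (partitionGraph R) (partitionGraph R') → SameRel R R'
  partitionGraph-injective G≐G' = starForest-injective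
    (≐-trans (≐-sym (complement-involutive (proj₂ (StarForest.starForest-isGraph R-equiv))))
      (≐-trans (complement-cong G≐G')
        (complement-involutive (proj₂ (StarForest.starForest-isGraph R'-equiv)))))

-- Upper bound: components and their universal vertices

module _ {n : ℕ} (G : Rel₂ n) where

  universalInComponent : Fin n → Bool
  universalInComponent x = does (universal? (complement G) (near? (complement G) x) x)

  sameComponent : Rel₂ n
  sameComponent i j = does (near? (complement G) i j)

  profile : (Fin n → Bool) × Rel₂ n
  profile = universalInComponent , sameComponent

module Profile {n : ℕ} {G : Rel₂ n} (G-inClass : InClass IsCliqueJoinStableOn G) where

  private
    H = complement G
    H-graph : IsGraph H
    H-graph = complement-isGraph (proj₁ (proj₁ G-inClass))
    every : EveryComponent IsCliqueJoinStableOn H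
    every = proj₂ G-inClass
    inComp⇒near : ∀ {v u} → InComp H v u → Near H v u
    inComp⇒near = nearClosed⇒inComp⇒near (everyComponent⇒nearClosed cliqueJoinStable-admissible H-graph every)
    near-sym : ∀ {v u} → Near H v u → Near H u v
    near-sym = inComp⇒near ∘ inComp-sym H-graph ∘ near⇒inComp

  sameComponent-isEquivRel : IsEquivRel (sameComponent G)
  sameComponent-isEquivRel =
    (λ i → dec-true (near? H i i) (inj₁ refl)) ,
    (λ i j ij → dec-true (near? H j i) (near-sym (does⇒ (near? H i j) ij))) ,
    (λ i j k ij jk → dec-true (near? H i k)
      (inComp⇒near (near⇒inComp (does⇒ (near? H i j) ij) ◅◅ near⇒inComp (does⇒ (near? H j k) jk))))

  complement-from-profile : ∀ {i j} → i ≢ j →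
    complement G i j ≡ (sameComponent G i j ∧ (universalInComponent G i ∨ universalInComponent G j))
  complement-from-profile {i} {j} i≢j =
    ≡does (near? H i j ×-dec (universal? H (near? H i) i ⊎-dec universal? H (near? H j) j)) to from
    where
    to : Adj H i j → Near H i j × (Universal H (Near H i) i ⊎ Universal H (Near H j) j)
    to ij = inj₂ (inj₁ ij) ,
      Data.Sum.map (universal-mono {H = H} near⇒inComp)
                   (universal-mono {H = H} (λ jw → (ij ◅ ε) ◅◅ near⇒inComp jw))
                   (cliqueJoinStable⇒edgesMeetUniversal (every i) i j ε (ij ◅ ε) i≢j ij)
    from : Near H i j × (Universal H (Near H i) i ⊎ Universal H (Near H j) j) → Adj H i j
    from (near , inj₁ i-universal) = i-universal j near i≢j
    from (near , inj₂ j-universal) = adj-sym H-graph (j-universal i (near-sym near) (i≢j ∘ sym))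

profile-injective : {n : ℕ} {G G' : Rel₂ n} →
                    InClass IsCliqueJoinStableOn G → InClass IsCliqueJoinStableOn G' →
                    ×.Pointwise (Pointwise _≡_) SameRel (profile G) (profile G') → SameRel G G'
profile-injective {G = G} {G'} G-inClass G'-inClass (M≗M' , R≐R') i j with i ≟ j
... | yes refl = trans (proj₂ (proj₁ G-inClass) i) (sym (proj₂ (proj₁ G'-inClass) i))
... | no i≢j   = not-injective (begin
  not (G i j)             ≡⟨ complement-off G i≢j ⟨
  complement G i j        ≡⟨ Profile.complement-from-profile G-inClass i≢j ⟩
  sameComponent G i j ∧ (universalInComponent G i ∨ universalInComponent G j)
    ≡⟨ cong₂ _∧_ (R≐R' i j) (cong₂ _∨_ (M≗M' i) (M≗M' j)) ⟩
  sameComponent G' i j ∧ (universalInComponent G' i ∨ universalInComponent G' j)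
    ≡⟨ Profile.complement-from-profile G'-inClass i≢j ⟨
  complement G' i j       ≡⟨ complement-off G' i≢j ⟩
  not (G' i j)            ∎)
  where open ≡.≡-Reasoning

bell : ℕ → ℕ
bell n = proj₁ (count-partitions {n})

classSize : {C : ComponentProperty} → Admissible C → ℕ → ℕ
classSize C-admissible n = proj₁ (count-class C-admissible {n})

module _ {C : ComponentProperty} (C-admissible : Admissible C) where

  classSize-mono : ∀ n → classSize C-admissible n ≤ classSize C-admissible (suc n)
  classSize-mono n = count-≤-count (sameRel-isEquivalence {suc n})
    (proj₂ (count-class C-admissible {n})) (proj₂ (count-class C-admissible {suc n}))
    cone (cone-inClass C-admissible) (λ _ _ → cone-injective)

  bell≤classSize : ∀ n → bell n ≤ classSize C-admissible n
  bell≤classSize n = count-≤-count (sameRel-isEquivalence {n})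
    (proj₂ (count-partitions {n})) (proj₂ (count-class C-admissible {n}))
    partitionGraph (λ R-equiv → StarForest.partitionGraph-inClass R-equiv C-admissible)
    partitionGraph-injective

  classSize≤cliqueJoinStable : ∀ n → classSize C-admissible n ≤ classSize cliqueJoinStable-admissible n
  classSize≤cliqueJoinStable n = count-≤-count (sameRel-isEquivalence {n})
    (proj₂ (count-class C-admissible {n})) (proj₂ (count-class cliqueJoinStable-admissible {n}))
    id (Product.map₂ (Admissible.cliqueJoinStable C-admissible ∘_)) (λ _ _ → id)

cliqueJoinStable≤2^n*bell : ∀ n → classSize cliqueJoinStable-admissible n ≤ 2 ^ n * bell n
cliqueJoinStable≤2^n*bell n =
  let partitions , _ , _ , partitions-onto = proj₂ (count-partitions {n}) in
  count-≤-enumeration (×-isEquivalence (Pointwise.isEquivalence ≡.isEquivalence n) (sameRel-isEquivalence {n}))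
    (proj₂ (count-class cliqueJoinStable-admissible {n}))
    (pairs (functions bools n) partitions)
    (pairs-onto (Pointwise _≡_) SameRel (functions-onto _≡_ bools-onto n) partitions-onto)
    profile (λ G-inClass → tt , Profile.sameComponent-isEquivRel G-inClass) profile-injective

-- The bounds hold for every n.
theorem-for : {C : ComponentProperty} → Admissible C →
  Σ (ℕ → ℕ) λ f → Σ (ℕ → ℕ) λ B →
    (∀ n → 1 ≤ n → IsCount {Rel₂ n} SameRel (InClass C) (f n)) × (∀ n → 1 ≤ n → BellCount n (B n)) ×
    (∀ n → 1 ≤ n → f n ≤ f (suc n)) ×
    (∀ n → 1 ≤ n → B n ≤ f n × f n ≤ 2 ^ n * B n)
theorem-for C-admissible =
  classSize C-admissible , bell ,
  (λ n _ → proj₂ (count-class C-admissible {n})) , (λ n _ → proj₂ (count-partitions {n})) ,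
  (λ n _ → classSize-mono C-admissible n) ,
  (λ n _ → bell≤classSize C-admissible n ,
           ≤-trans (classSize≤cliqueJoinStable C-admissible n) (cliqueJoinStable≤2^n*bell n))

mainTheorem11 : (k : Fin 3) →
    Σ (ℕ → ℕ) λ f → Σ (ℕ → ℕ) λ B →
      (∀ n → 1 ≤ n → GraphCount k n (f n)) × (∀ n → 1 ≤ n → BellCount n (B n)) ×
      (∀ n → 1 ≤ n → f n ≤ f (suc n)) ×
      (∀ n → 1 ≤ n → B n ≤ f n × f n ≤ 2 ^ n * B n)
mainTheorem11 zero             = theorem-for starOrTriangle-admissible
mainTheorem11 (suc zero)       = theorem-for starOrClique-admissible
mainTheorem11 (suc (suc zero)) = theorem-for cliqueJoinStable-admissible
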